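{- Let $b\ge 2$ be an integer and let $x=0.a_1a_2a_3\cdots$ (base-$b$ expansion, digits $a_j\in\{0,1,\dots,b-1\}$) be normal to base $b$. Let $n_1\in\mathbb{N}$ be arbitrary and define the sequence $(n_i)_{i\ge1}$ recursively by \[ n_{i+1}=n_i+1+a_{n_i},\qquad i\ge 1 . \] Then the number $0.a_{n_1}a_{n_2}a_{n_3}\cdots$ is normal to base $b$.
   Context: For an integer base $b\ge 2$, a number with base-$b$ digit sequence $0.d_1d_2d_3\cdots$ ($d_j\in\{0,\dots,b-1\}$) is normal to base $b$ if for every $k\ge1$ and every finite string $[c_1,\dots,c_k]$ of base-$b$ digits, \[ \lim_{n\to\infty}\frac{\#\{0\le i\le n-1:\ d_{i+j}=c_j \text{ for } 1\le j\le k\}}{n}=\frac{1}{b^k}. \] -}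

module Defs where

open import Data.Nat using (ℕ; zero; suc; _+_; _^_; _≤_; NonZero)
open import Data.Nat.Properties using (m^n≢0)
open import Data.Fin using (Fin; toℕ)
open import Data.Fin.Properties using (_≟_)
open import Data.List using (List; []; _∷_; length)
open import Data.Bool using (Bool; true; false; _∧_)
open import Data.Integer using (+_)
open import Data.Rational using (ℚ; _/_; 0ℚ; _-_; ∣_∣; _<_; Positive)
open import Data.Product using (∃)
open import Relation.Nullary.Decidable using (⌊_⌋)

-- Digit sequences are 0-indexed functions  d : ℕ → Fin b,
-- where  d i  is the digit  d_{i+1}  of the paper.

occursAt : {b : ℕ} → (ℕ → Fin b) → ℕ → List (Fin b) → Bool
occursAt d i []       = true
occursAt d i (c ∷ cs) = ⌊ d i ≟ c ⌋ ∧ occursAt d (suc i) cs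

count : {b : ℕ} → (ℕ → Fin b) → List (Fin b) → ℕ → ℕ
count d c zero    = zero
count d c (suc n) with occursAt d n c
... | true  = suc (count d c n)
... | false = count d c n

-- the frequency count/n (value at n = 0 is irrelevant for the limit)
freq : {b : ℕ} → (ℕ → Fin b) → List (Fin b) → ℕ → ℚ
freq d c zero    = 0ℚ
freq d c (suc n) = + count d c (suc n) / suc n

-- 1 / b^k  (b = 0 case is irrelevant, since b ≥ 2 always)
invPow : ℕ → ℕ → ℚ
invPow zero    k = 0ℚ
invPow (suc b) k = (+ 1 / (suc b ^ k)) {{m^n≢0 (suc b) k}}

ConvergesTo : (ℕ → ℚ) → ℚ → Set
ConvergesTo f L = ∀ (ε : ℚ) → Positive ε → ∃ λ (N : ℕ) → ∀ (n : ℕ) → N ≤ n → ∣ f n - L ∣ < ε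

Normal : (b : ℕ) → (ℕ → Fin b) → Set
Normal b d = ∀ (c : List (Fin b)) → 1 ≤ length c → ConvergesTo (freq d c) (invPow b (length c))

-- the index sequence: idx a n₁ 0 = n₁, idx a n₁ (i+1) = idx i + 1 + a_{idx i}
-- (here  a  is indexed so that  a j  is the paper's digit a_j, j ≥ 1)
idx : {b : ℕ} → (ℕ → Fin b) → ℕ → ℕ → ℕ
idx a n₁ zero    = n₁
idx a n₁ (suc i) = idx a n₁ i + 1 + toℕ (a (idx a n₁ i))

-- Let x be the digit sequence a₂a₃… and read the selection rule as an automaton whose state
-- is the number of digits still to be skipped; past the first selected index the state is at
-- most b − 1, and a run of b − 1 zeros resets every such state to 0. So whether position
-- p + L is selected, and which string the selected digits spell from there, is a function of
-- the window of length L + R of x at p, except for windows with none of j aligned zero blocks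
-- in their first L digits; by normality these have density ((b^(b-1) − 1)/b^(b-1))^j, which
-- is negligible for large j. Counting selected positions and selected occurrences of a string
-- c therefore amounts to averaging window functions along x, and normality turns these into
-- averages over all words. The two averages differ exactly by the factor b^|c|, because the
-- parse of c prescribes |c| digits of the window and leaves the others free.

module Submission where

open import Data.Bool using (Bool; true; false; _∧_; _∨_; not; T)
open import Data.Empty using (⊥-elim)
open import Data.Fin using (Fin; zero; suc; toℕ)
open import Data.Fin.Properties using (_≟_; toℕ≤pred[n]; toℕ<n)
open import Data.List using (List; []; _∷_; length; _++_; drop; take)
open import Data.List.Properties using (take++drop≡id)
open import Data.Nat hiding (_≟_)
open import Data.Nat.Properties hiding (_≟_)
open import Data.Nat.Tactic.RingSolver using (solve-∀)
open import Data.Product using (_×_; _,_; proj₁; proj₂; ∃)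
open import Data.Sum using (inj₁; inj₂)
open import Relation.Nullary.Decidable using (⌊_⌋; yes; no)
open import Relation.Binary.PropositionalEquality
open import Data.Integer.GCD using (gcd)
open import Defs
import Data.Integer as ℤ
open ℤ using (+[1+_])
import Data.Integer.Properties as ℤP
import Data.Integer.Tactic.RingSolver as ℤSolver
import Data.Rational as ℚ
import Data.Rational.Properties as ℚP
import Data.Rational.Unnormalised as ℚᵘ
import Data.Rational.Unnormalised.Properties as ℚᵘP

𝟙 : Bool → ℕ
𝟙 true  = 1
𝟙 false = 0

𝟙≤1 : ∀ x → 𝟙 x ≤ 1
𝟙≤1 true  = ≤-refl
𝟙≤1 false = z≤n

𝟙-∧ : ∀ x y → 𝟙 (x ∧ y) ≡ 𝟙 x * 𝟙 y
𝟙-∧ true  y = sym (+-identityʳ _)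
𝟙-∧ false y = refl

𝟙*≤1 : ∀ x {n} → n ≤ 1 → 𝟙 x * n ≤ 1
𝟙*≤1 true  {n} n≤1 = ≤-trans (≤-reflexive (+-identityʳ n)) n≤1
𝟙*≤1 false n≤1 = z≤n

𝟙-not+𝟙 : ∀ x → 𝟙 (not x) + 𝟙 x ≡ 1
𝟙-not+𝟙 true  = refl
𝟙-not+𝟙 false = refl

𝟙-not-∨ : ∀ x y → 𝟙 (not (x ∨ y)) ≡ 𝟙 (not x) * 𝟙 (not y)
𝟙-not-∨ true  y = refl
𝟙-not-∨ false y = sym (+-identityʳ _)

infix 4 _≈[_]_

_≈[_]_ : ℕ → ℕ → ℕ → Set
x ≈[ e ] y = (x ≤ y + e) × (y ≤ x + e)

≈-refl : ∀ {x} e → x ≈[ e ] x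
≈-refl {x} e = m≤m+n x e , m≤m+n x e

≈-reflexive : ∀ {x y} e → x ≡ y → x ≈[ e ] y
≈-reflexive e refl = ≈-refl e

≈-sym : ∀ {x y e} → x ≈[ e ] y → y ≈[ e ] x
≈-sym (x≤y+e , y≤x+e) = y≤x+e , x≤y+e

≈-trans : ∀ {x y z e f} → x ≈[ e ] y → y ≈[ f ] z → x ≈[ e + f ] z
≈-trans {x} {y} {z} {e} {f} (x≤y+e , y≤x+e) (y≤z+f , z≤y+f) =
  ≤-trans x≤y+e (≤-trans (+-monoˡ-≤ e y≤z+f) (≤-reflexive (trans (+-assoc z f e) (cong (z +_) (+-comm f e))))) ,
  ≤-trans z≤y+f (≤-trans (+-monoˡ-≤ f y≤x+e) (≤-reflexive (+-assoc x e f)))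

≈-weaken : ∀ {x y e e'} → e ≤ e' → x ≈[ e ] y → x ≈[ e' ] y
≈-weaken e≤e' (x≤y+e , y≤x+e) = ≤-trans x≤y+e (+-monoʳ-≤ _ e≤e') , ≤-trans y≤x+e (+-monoʳ-≤ _ e≤e')

≈-respˡ : ∀ {x x' y e} → x ≡ x' → x ≈[ e ] y → x' ≈[ e ] y
≈-respˡ refl x≈y = x≈y

≈-respʳ : ∀ {x y y' e} → y ≡ y' → x ≈[ e ] y → x ≈[ e ] y'
≈-respʳ refl x≈y = x≈y

≈-resp-error : ∀ {x y e e'} → e ≡ e' → x ≈[ e ] y → x ≈[ e' ] y
≈-resp-error refl x≈y = x≈y

≈-+ : ∀ {x y u v e f} → x ≈[ e ] y → u ≈[ f ] v → x + u ≈[ e + f ] y + v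
≈-+ {x} {y} {u} {v} {e} {f} (x≤y+e , y≤x+e) (u≤v+f , v≤u+f) =
  ≤-trans (+-mono-≤ x≤y+e u≤v+f) (≤-reflexive (interchange y e v f)) ,
  ≤-trans (+-mono-≤ y≤x+e v≤u+f) (≤-reflexive (interchange x e u f))
  where
  interchange : ∀ a b c d → (a + b) + (c + d) ≡ (a + c) + (b + d)
  interchange = solve-∀

≈-*ˡ : ∀ c {x y e} → x ≈[ e ] y → c * x ≈[ c * e ] c * y
≈-*ˡ c {x} {y} {e} (x≤y+e , y≤x+e) =
  ≤-trans (*-monoʳ-≤ c x≤y+e) (≤-reflexive (*-distribˡ-+ c y e)) ,
  ≤-trans (*-monoʳ-≤ c y≤x+e) (≤-reflexive (*-distribˡ-+ c x e))

≤1⇒≈[1] : ∀ {x y} → x ≤ 1 → y ≤ 1 → x ≈[ 1 ] y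
≤1⇒≈[1] {x} {y} x≤1 y≤1 = ≤-trans x≤1 (m≤n+m 1 y) , ≤-trans y≤1 (m≤n+m 1 x)

≈-cancel-*ˡ : ∀ m q {u v e e'} .{{_ : NonZero m}} →
              m * u ≈[ e ] m * v → q * e ≤ m * e' → q * u ≈[ e' ] q * v
≈-cancel-*ˡ m q {e = e} {e'} (mu≤mv+e , mv≤mu+e) qe≤me' = cancel mu≤mv+e , cancel mv≤mu+e
  where
  open ≤-Reasoning
  cancel : ∀ {s t} → m * s ≤ m * t + e → q * s ≤ q * t + e'
  cancel {s} {t} ms≤mt+e = *-cancelˡ-≤ m (begin
    m * (q * s)          ≡⟨ x*[y*z]≡y*[x*z] m q s ⟩
    q * (m * s)          ≤⟨ *-monoʳ-≤ q ms≤mt+e ⟩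
    q * (m * t + e)      ≡⟨ *-distribˡ-+ q (m * t) e ⟩
    q * (m * t) + q * e  ≤⟨ +-monoʳ-≤ (q * (m * t)) qe≤me' ⟩
    q * (m * t) + m * e' ≡⟨ regroup m q t e' ⟩
    m * (q * t + e')     ∎)
    where
    x*[y*z]≡y*[x*z] : ∀ x y z → x * (y * z) ≡ y * (x * z)
    x*[y*z]≡y*[x*z] = solve-∀
    regroup : ∀ x y z w → y * (x * z) + x * w ≡ x * (y * z + w)
    regroup = solve-∀

∣-∣≤⇒≈ : ∀ x y {e} → ∣ x - y ∣ ≤ e → x ≈[ e ] y
∣-∣≤⇒≈ x y {e} ∣x-y∣≤e with ≤-total x y
... | inj₁ x≤y = ≤-trans x≤y (m≤m+n y e) ,
                 ≤-trans (≤-reflexive (sym (m+[n∸m]≡n x≤y)))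
                         (+-monoʳ-≤ x (≤-trans (≤-reflexive (sym (m≤n⇒∣m-n∣≡n∸m x≤y))) ∣x-y∣≤e))
... | inj₂ y≤x = ≤-trans (≤-reflexive (sym (m+[n∸m]≡n y≤x)))
                         (+-monoʳ-≤ y (≤-trans (≤-reflexive (sym (trans (∣-∣-comm x y) (m≤n⇒∣m-n∣≡n∸m y≤x)))) ∣x-y∣≤e)) ,
                 ≤-trans y≤x (m≤m+n x e)

≈⇒∣-∣≤ : ∀ x y {e} → x ≈[ e ] y → ∣ x - y ∣ ≤ e
≈⇒∣-∣≤ x y {e} (x≤y+e , y≤x+e) with ≤-total x y
... | inj₁ x≤y = ≤-trans (≤-reflexive (m≤n⇒∣m-n∣≡n∸m x≤y))
                         (≤-trans (∸-monoˡ-≤ x y≤x+e) (≤-reflexive (m+n∸m≡n x e)))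
... | inj₂ y≤x = ≤-trans (≤-reflexive (trans (∣-∣-comm x y) (m≤n⇒∣m-n∣≡n∸m y≤x)))
                         (≤-trans (∸-monoˡ-≤ y x≤y+e) (≤-reflexive (m+n∸m≡n y e)))

sumTo : (ℕ → ℕ) → ℕ → ℕ
sumTo f zero    = 0
sumTo f (suc n) = sumTo f n + f n

sumTo-cong : ∀ {f g} n → (∀ i → i < n → f i ≡ g i) → sumTo f n ≡ sumTo g n
sumTo-cong zero    f≡g = refl
sumTo-cong (suc n) f≡g = cong₂ _+_ (sumTo-cong n (λ i i<n → f≡g i (m<n⇒m<1+n i<n))) (f≡g n ≤-refl)

sumTo-+ : ∀ f g n → sumTo (λ i → f i + g i) n ≡ sumTo f n + sumTo g n
sumTo-+ f g zero    = refl
sumTo-+ f g (suc n) rewrite sumTo-+ f g n = interchange (sumTo f n) (sumTo g n) (f n) (g n)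
  where
  interchange : ∀ a b c d → a + b + (c + d) ≡ a + c + (b + d)
  interchange = solve-∀

sumTo-*ˡ : ∀ c f n → sumTo (λ i → c * f i) n ≡ c * sumTo f n
sumTo-*ˡ c f zero    = sym (*-zeroʳ c)
sumTo-*ˡ c f (suc n) rewrite sumTo-*ˡ c f n = sym (*-distribˡ-+ c (sumTo f n) (f n))

sumTo-mono-≤ : ∀ {f g} n → (∀ i → f i ≤ g i) → sumTo f n ≤ sumTo g n
sumTo-mono-≤ zero    f≤g = z≤n
sumTo-mono-≤ (suc n) f≤g = +-mono-≤ (sumTo-mono-≤ n f≤g) (f≤g n)

sumTo-const : ∀ c n → sumTo (λ _ → c) n ≡ n * c
sumTo-const c zero    = refl
sumTo-const c (suc n) rewrite sumTo-const c n = +-comm (n * c) c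

sumTo-zero : ∀ {f} n → (∀ i → i < n → f i ≡ 0) → sumTo f n ≡ 0
sumTo-zero n f≡0 = trans (sumTo-cong n f≡0) (trans (sumTo-const 0 n) (*-zeroʳ n))

sumTo-+-range : ∀ f m n → sumTo f (m + n) ≡ sumTo f m + sumTo (λ i → f (m + i)) n
sumTo-+-range f m zero    = trans (cong (sumTo f) (+-identityʳ m)) (sym (+-identityʳ _))
sumTo-+-range f m (suc n) rewrite +-suc m n | sumTo-+-range f m n = +-assoc (sumTo f m) _ _

sumTo-≤1 : ∀ f n → (∀ i → f i ≤ 1) → sumTo f n ≤ n
sumTo-≤1 f n f≤1 = ≤-trans (sumTo-mono-≤ n f≤1) (≤-reflexive (trans (sumTo-const 1 n) (*-identityʳ n)))

sumTo-≈ : ∀ {f g e : ℕ → ℕ} n → (∀ i → f i ≈[ e i ] g i) → sumTo f n ≈[ sumTo e n ] sumTo g n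
sumTo-≈ zero    f≈g = ≈-refl 0
sumTo-≈ (suc n) f≈g = ≈-+ (sumTo-≈ n f≈g) (f≈g n)

sumTo-shift-≈ : ∀ f L n → (∀ i → f i ≤ 1) → sumTo f n ≈[ L ] sumTo (λ i → f (i + L)) n
sumTo-shift-≈ f L n f≤1 =
  ≤-trans (m≤m+n _ _) (≤-trans (≤-reflexive head+tail≡all)
    (≤-trans (≤-reflexive all≡start+shifted) (≤-trans (+-monoˡ-≤ _ start≤L) (≤-reflexive (+-comm L _))))) ,
  ≤-trans (m≤n+m _ (sumTo f L)) (≤-trans (≤-reflexive (sym all≡start+shifted))
    (≤-trans (≤-reflexive (sym head+tail≡all)) (+-monoʳ-≤ (sumTo f n) tail≤L)))
  where
  all≡start+shifted : sumTo f (L + n) ≡ sumTo f L + sumTo (λ i → f (i + L)) n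
  all≡start+shifted = trans (sumTo-+-range f L n) (cong (sumTo f L +_) (sumTo-cong n (λ i _ → cong f (+-comm L i))))
  head+tail≡all : sumTo f n + sumTo (λ i → f (n + i)) L ≡ sumTo f (L + n)
  head+tail≡all = trans (sym (sumTo-+-range f n L)) (cong (sumTo f) (+-comm n L))
  start≤L : sumTo f L ≤ L
  start≤L = sumTo-≤1 f L f≤1
  tail≤L : sumTo (λ i → f (n + i)) L ≤ L
  tail≤L = sumTo-≤1 _ L (λ i → f≤1 (n + i))

sumTo-<ᵇ≤ : ∀ m n → sumTo (λ i → 𝟙 (i <ᵇ m)) n ≤ m
sumTo-<ᵇ≤ m zero = z≤n
sumTo-<ᵇ≤ m (suc n) with n <ᵇ m in eq
... | true  = ≤-trans (≤-reflexive (+-comm _ 1))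
                (≤-trans (s≤s (sumTo-≤1 _ n (λ i → 𝟙≤1 (i <ᵇ m)))) (<ᵇ⇒< n m (subst T (sym eq) _)))
... | false = ≤-trans (≤-reflexive (+-identityʳ _)) (sumTo-<ᵇ≤ m n)

sumFin : (n : ℕ) → (Fin n → ℕ) → ℕ
sumFin zero    f = 0
sumFin (suc n) f = f zero + sumFin n (λ d → f (suc d))

sumFin-cong : ∀ n {f g} → (∀ d → f d ≡ g d) → sumFin n f ≡ sumFin n g
sumFin-cong zero    f≡g = refl
sumFin-cong (suc n) f≡g = cong₂ _+_ (f≡g zero) (sumFin-cong n (λ d → f≡g (suc d)))

sumFin-+ : ∀ n f g → sumFin n (λ d → f d + g d) ≡ sumFin n f + sumFin n g
sumFin-+ zero    f g = refl
sumFin-+ (suc n) f g rewrite sumFin-+ n (λ d → f (suc d)) (λ d → g (suc d)) =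
  interchange (f zero) (g zero) (sumFin n (λ d → f (suc d))) (sumFin n (λ d → g (suc d)))
  where
  interchange : ∀ a b c d → a + b + (c + d) ≡ a + c + (b + d)
  interchange = solve-∀

sumFin-*ˡ : ∀ n c f → sumFin n (λ d → c * f d) ≡ c * sumFin n f
sumFin-*ˡ zero    c f = sym (*-zeroʳ c)
sumFin-*ˡ (suc n) c f rewrite sumFin-*ˡ n c (λ d → f (suc d)) = sym (*-distribˡ-+ c _ _)

sumFin-mono-≤ : ∀ n {f g} → (∀ d → f d ≤ g d) → sumFin n f ≤ sumFin n g
sumFin-mono-≤ zero    f≤g = z≤n
sumFin-mono-≤ (suc n) f≤g = +-mono-≤ (f≤g zero) (sumFin-mono-≤ n (λ d → f≤g (suc d)))

sumFin-const : ∀ n c → sumFin n (λ _ → c) ≡ n * c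
sumFin-const zero    c = refl
sumFin-const (suc n) c = cong (c +_) (sumFin-const n c)

sumFin-≈ : ∀ n {f g e : Fin n → ℕ} → (∀ d → f d ≈[ e d ] g d) → sumFin n f ≈[ sumFin n e ] sumFin n g
sumFin-≈ zero    f≈g = ≈-refl 0
sumFin-≈ (suc n) f≈g = ≈-+ (f≈g zero) (sumFin-≈ n (λ d → f≈g (suc d)))

⌊≟⌋-sym : ∀ {n} (d e : Fin n) → ⌊ d ≟ e ⌋ ≡ ⌊ e ≟ d ⌋
⌊≟⌋-sym d e with d ≟ e | e ≟ d
... | yes _   | yes _   = refl
... | no  _   | no  _   = refl
... | yes d≡e | no  e≢d = ⊥-elim (e≢d (sym d≡e))
... | no  d≢e | yes e≡d = ⊥-elim (d≢e (sym e≡d))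

⌊suc≟suc⌋ : ∀ {n} (d e : Fin n) → ⌊ suc d ≟ suc e ⌋ ≡ ⌊ d ≟ e ⌋
⌊suc≟suc⌋ d e with d ≟ e
... | yes _ = refl
... | no  _ = refl

sumFin-select : ∀ n (e : Fin n) g → sumFin n (λ d → 𝟙 ⌊ e ≟ d ⌋ * g d) ≡ g e
sumFin-select (suc n) zero g =
  trans (cong₂ _+_ (+-identityʳ (g zero)) (trans (sumFin-const n 0) (*-zeroʳ n))) (+-identityʳ _)
sumFin-select (suc n) (suc e) g =
  trans (sumFin-cong n (λ d → cong (λ t → 𝟙 t * g (suc d)) (⌊suc≟suc⌋ e d))) (sumFin-select n e (λ d → g (suc d)))

sumFin-selectʳ : ∀ n (e : Fin n) g → sumFin n (λ d → 𝟙 ⌊ d ≟ e ⌋ * g d) ≡ g e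
sumFin-selectʳ n e g = trans (sumFin-cong n (λ d → cong (λ t → 𝟙 t * g d) (⌊≟⌋-sym d e))) (sumFin-select n e g)

sumWords : (b n : ℕ) → (List (Fin b) → ℕ) → ℕ
sumWords b zero    f = f []
sumWords b (suc n) f = sumFin b (λ d → sumWords b n (λ w → f (d ∷ w)))

module _ (b : ℕ) where

  sumWords-cong : ∀ n {f g} → (∀ w → length w ≡ n → f w ≡ g w) → sumWords b n f ≡ sumWords b n g
  sumWords-cong zero    f≡g = f≡g [] refl
  sumWords-cong (suc n) f≡g = sumFin-cong b (λ d → sumWords-cong n (λ w ∣w∣≡n → f≡g (d ∷ w) (cong suc ∣w∣≡n)))

  sumWords-+ : ∀ n f g → sumWords b n (λ w → f w + g w) ≡ sumWords b n f + sumWords b n g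
  sumWords-+ zero    f g = refl
  sumWords-+ (suc n) f g =
    trans (sumFin-cong b (λ d → sumWords-+ n (λ w → f (d ∷ w)) (λ w → g (d ∷ w)))) (sumFin-+ b _ _)

  sumWords-*ˡ : ∀ n c f → sumWords b n (λ w → c * f w) ≡ c * sumWords b n f
  sumWords-*ˡ zero    c f = refl
  sumWords-*ˡ (suc n) c f = trans (sumFin-cong b (λ d → sumWords-*ˡ n c (λ w → f (d ∷ w)))) (sumFin-*ˡ b c _)

  sumWords-*ʳ : ∀ n c f → sumWords b n (λ w → f w * c) ≡ sumWords b n f * c
  sumWords-*ʳ n c f =
    trans (sumWords-cong n (λ w _ → *-comm (f w) c)) (trans (sumWords-*ˡ n c f) (*-comm c _))

  sumWords-mono-≤ : ∀ n {f g} → (∀ w → length w ≡ n → f w ≤ g w) → sumWords b n f ≤ sumWords b n g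
  sumWords-mono-≤ zero    f≤g = f≤g [] refl
  sumWords-mono-≤ (suc n) f≤g = sumFin-mono-≤ b (λ d → sumWords-mono-≤ n (λ w ∣w∣≡n → f≤g (d ∷ w) (cong suc ∣w∣≡n)))

  sumWords-const : ∀ n c → sumWords b n (λ _ → c) ≡ b ^ n * c
  sumWords-const zero    c = sym (+-identityʳ c)
  sumWords-const (suc n) c = trans (sumFin-cong b (λ d → sumWords-const n c))
                               (trans (sumFin-const b _) (sym (*-assoc b (b ^ n) c)))

  sumWords-≈ : ∀ n {f g e : List (Fin b) → ℕ} → (∀ w → length w ≡ n → f w ≈[ e w ] g w) →
               sumWords b n f ≈[ sumWords b n e ] sumWords b n g
  sumWords-≈ zero    f≈g = f≈g [] refl
  sumWords-≈ (suc n) f≈g = sumFin-≈ b (λ d → sumWords-≈ n (λ w ∣w∣≡n → f≈g (d ∷ w) (cong suc ∣w∣≡n)))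

  sumWords-++ : ∀ m n f → sumWords b (m + n) f ≡ sumWords b m (λ u → sumWords b n (λ v → f (u ++ v)))
  sumWords-++ zero    n f = refl
  sumWords-++ (suc m) n f = sumFin-cong b (λ d → sumWords-++ m n (λ w → f (d ∷ w)))

  sumWords-sumTo : ∀ n (F : List (Fin b) → ℕ → ℕ) P →
                   sumWords b n (λ w → sumTo (F w) P) ≡ sumTo (λ i → sumWords b n (λ w → F w i)) P
  sumWords-sumTo n F zero    = trans (sumWords-const n 0) (*-zeroʳ (b ^ n))
  sumWords-sumTo n F (suc P) = trans (sumWords-+ n (λ w → sumTo (F w) P) (λ w → F w P))
                                     (cong (_+ sumWords b n (λ w → F w P)) (sumWords-sumTo n F P))

drop-++ : ∀ {A : Set} m (u v : List A) → length u ≡ m → drop m (u ++ v) ≡ v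
drop-++ zero    []      v _       = refl
drop-++ (suc m) (_ ∷ u) v ∣u∣≡1+m = drop-++ m u v (suc-injective ∣u∣≡1+m)

take-++ : ∀ {A : Set} m (u v : List A) → length u ≡ m → take m (u ++ v) ≡ u
take-++ zero    []      v _       = refl
take-++ (suc m) (a ∷ u) v ∣u∣≡1+m = cong (a ∷_) (take-++ m u v (suc-injective ∣u∣≡1+m))

sumWords-drop : ∀ b m n g → sumWords b (m + n) (λ w → g (drop m w)) ≡ b ^ m * sumWords b n g
sumWords-drop b m n g = trans (sumWords-++ b m n (λ w → g (drop m w)))
  (trans (sumWords-cong b m (λ u ∣u∣≡m → sumWords-cong b n (λ v _ → cong g (drop-++ m u v ∣u∣≡m))))
         (sumWords-const b m (sumWords b n g)))

window : ∀ {b} → (ℕ → Fin b) → ℕ → ℕ → List (Fin b)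
window x p zero    = []
window x p (suc n) = x p ∷ window x (suc p) n

drop-window : ∀ {b} (x : ℕ → Fin b) m p n → drop m (window x p (m + n)) ≡ window x (p + m) n
drop-window x zero    p n = cong (λ q → window x q n) (sym (+-identityʳ p))
drop-window x (suc m) p n = trans (drop-window x m (suc p) n) (cong (λ q → window x q n) (sym (+-suc p m)))

take-window : ∀ {b} (x : ℕ → Fin b) m p n → take m (window x p (m + n)) ≡ window x p m
take-window x zero    p n = refl
take-window x (suc m) p n = cong (x p ∷_) (take-window x m (suc p) n)

count≡sumTo-occursAt : ∀ {b} (x : ℕ → Fin b) c n → count x c n ≡ sumTo (λ i → 𝟙 (occursAt x i c)) n
count≡sumTo-occursAt x c zero = refl
count≡sumTo-occursAt x c (suc n) with occursAt x n c
... | true  = trans (cong suc (count≡sumTo-occursAt x c n)) (+-comm 1 _)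
... | false = trans (count≡sumTo-occursAt x c n) (sym (+-identityʳ _))

count-cong : ∀ {b} {d d′ : ℕ → Fin b} → (∀ i → d i ≡ d′ i) → ∀ c n → count d c n ≡ count d′ c n
count-cong {d = d} {d′} d≡d′ c n = begin
  count d c n                             ≡⟨ count≡sumTo-occursAt d c n ⟩
  sumTo (λ i → 𝟙 (occursAt d i c)) n      ≡⟨ sumTo-cong n (λ i _ → cong 𝟙 (occursAt-cong c i)) ⟩
  sumTo (λ i → 𝟙 (occursAt d′ i c)) n     ≡⟨ sym (count≡sumTo-occursAt d′ c n) ⟩
  count d′ c n                            ∎
  where
  open ≡-Reasoning
  occursAt-cong : ∀ c i → occursAt d i c ≡ occursAt d′ i c
  occursAt-cong []       i = refl
  occursAt-cong (c ∷ cs) i rewrite d≡d′ i | occursAt-cong cs (suc i) = refl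

module _ {b : ℕ} (x : ℕ → Fin b) where

  sumWords-occursAt : ∀ n p (f : List (Fin b) → ℕ) →
                      sumWords b n (λ w → 𝟙 (occursAt x p w) * f w) ≡ f (window x p n)
  sumWords-occursAt zero    p f = +-identityʳ _
  sumWords-occursAt (suc n) p f =
    trans (sumFin-cong b (λ d → trans
             (sumWords-cong b n (λ w _ → trans (cong (_* f (d ∷ w)) (𝟙-∧ ⌊ x p ≟ d ⌋ (occursAt x (suc p) w)))
                                               (*-assoc (𝟙 ⌊ x p ≟ d ⌋) (𝟙 (occursAt x (suc p) w)) (f (d ∷ w)))))
             (trans (sumWords-*ˡ b n (𝟙 ⌊ x p ≟ d ⌋) (λ w → 𝟙 (occursAt x (suc p) w) * f (d ∷ w)))
                    (cong (𝟙 ⌊ x p ≟ d ⌋ *_) (sumWords-occursAt n (suc p) (λ w → f (d ∷ w)))))))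
          (sumFin-select b (x p) (λ d → f (d ∷ window x (suc p) n)))

  sumWords-*count : ∀ n (f : List (Fin b) → ℕ) P →
                    sumWords b n (λ w → f w * count x w P) ≡ sumTo (λ i → f (window x i n)) P
  sumWords-*count n f P = begin
    sumWords b n (λ w → f w * count x w P)
      ≡⟨ sumWords-cong b n (λ w _ → trans (cong (f w *_) (count≡sumTo-occursAt x w P))
                                          (sym (sumTo-*ˡ (f w) (λ i → 𝟙 (occursAt x i w)) P))) ⟩
    sumWords b n (λ w → sumTo (λ i → f w * 𝟙 (occursAt x i w)) P)
      ≡⟨ sumWords-sumTo b n (λ w i → f w * 𝟙 (occursAt x i w)) P ⟩
    sumTo (λ i → sumWords b n (λ w → f w * 𝟙 (occursAt x i w))) P
      ≡⟨ sumTo-cong P (λ i _ → trans (sumWords-cong b n (λ w _ → *-comm (f w) _)) (sumWords-occursAt n i f)) ⟩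
    sumTo (λ i → f (window x i n)) P ∎
    where open ≡-Reasoning

-- f n / n → 1 / D, stated in ℕ:  ∣ D·f n − n ∣ ≤ n / q eventually, for every q.
HasDensity : (ℕ → ℕ) → ℕ → Set
HasDensity f D = ∀ q → ∃ λ N → ∀ n → N ≤ n → q * (D * f n) ≈[ n ] q * n

HasDensity-cong : ∀ {f g : ℕ → ℕ} D → (∀ n → f n ≡ g n) → HasDensity f D → HasDensity g D
HasDensity-cong D f≡g dens q =
  proj₁ (dens q) , λ n N≤n → subst (λ z → q * (D * z) ≈[ n ] q * n) (f≡g n) (proj₂ (dens q) n N≤n)

private
  nonZero⇒suc : ∀ n → .{{NonZero n}} → ∃ λ n' → n ≡ suc n'
  nonZero⇒suc (suc n) = n , refl

  ∣⊖∣≡∣-∣ : ∀ m n → ℤ.∣ m ℤ.⊖ n ∣ ≡ ∣ m - n ∣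
  ∣⊖∣≡∣-∣ m n with ≤-total m n
  ... | inj₁ m≤n = trans (ℤP.∣⊖∣-≤ m≤n) (sym (m≤n⇒∣m-n∣≡n∸m m≤n))
  ... | inj₂ n≤m = trans (ℤP.∣m⊖n∣≡∣n⊖m∣ m n)
                         (trans (ℤP.∣⊖∣-≤ n≤m) (sym (trans (∣-∣-comm m n) (m≤n⇒∣m-n∣≡n∸m n≤m))))

  toℚᵘ-/ : ∀ i n .{{_ : NonZero n}} n' → n ≡ suc n' → ℚ.toℚᵘ (i ℚ./ n) ℚᵘ.≃ ℚᵘ.mkℚᵘ i n'
  toℚᵘ-/ i n n' n≡1+n' = ℚᵘ.*≡* (trans (cong₂ (λ u z → u ℤ.* ℤ.+ z) (ℚP.↥ᵘ-toℚᵘ p) (sym n≡1+n'))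
                                      (trans cross (cong (i ℤ.*_) (sym (ℚP.↧ᵘ-toℚᵘ p)))))
    where
    p : ℚ.ℚ
    p = i ℚ./ n
    g : ℤ.ℤ
    g = gcd i (ℤ.+ n)
    cross : ℚ.↥ p ℤ.* ℤ.+ n ≡ i ℤ.* ℚ.↧ p
    cross = begin
      ℚ.↥ p ℤ.* ℤ.+ n             ≡⟨ cong (ℚ.↥ p ℤ.*_) (sym (ℚP.↧-/ i n)) ⟩
      ℚ.↥ p ℤ.* (ℚ.↧ p ℤ.* g)   ≡⟨ reassoc (ℚ.↥ p) (ℚ.↧ p) g ⟩
      (ℚ.↥ p ℤ.* g) ℤ.* ℚ.↧ p   ≡⟨ cong (ℤ._* ℚ.↧ p) (ℚP.↥-/ i n) ⟩
      i ℤ.* ℚ.↧ p               ∎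
      where
      open ≡-Reasoning
      reassoc : ∀ a d c → a ℤ.* (d ℤ.* c) ≡ (a ℤ.* c) ℤ.* d
      reassoc = ℤSolver.solve-∀

  ∣a/n-1/D∣≡ : ∀ a n' D' → ℚᵘ.∣ ℚᵘ.mkℚᵘ (ℤ.+ a) n' ℚᵘ.- ℚᵘ.mkℚᵘ (ℤ.+ 1) D' ∣ ≡
               ℚᵘ.mkℚᵘ (ℤ.+ ∣ a * suc D' - suc n' ∣) (D' + n' * suc D')
  ∣a/n-1/D∣≡ a n' D' = cong (λ z → ℚᵘ.mkℚᵘ (ℤ.+ z) (D' + n' * suc D'))
    (trans (cong ℤ.∣_∣ (trans (cong₂ ℤ._+_ (sym (ℤP.pos-* a (suc D'))) (ℤP.-1*i≡-i (ℤ.+ suc n')))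
                              (ℤP.m-n≡m⊖n (a * suc D') (suc n'))))
           (∣⊖∣≡∣-∣ (a * suc D') (suc n')))

  -- mkℚᵘ i d denotes i / (1 + d); so with D = 1 + D' and n = 1 + n' this is ∣ a/n − 1/D ∣ = ∣ a·D − n ∣ / (n·D).
  ∣freq-invPow∣≃ : ∀ b' k a n' D' → suc b' ^ k ≡ suc D' →
    ℚ.toℚᵘ (ℚ.∣ (ℤ.+ a ℚ./ suc n') ℚ.- invPow (suc b') k ∣) ℚᵘ.≃ ℚᵘ.mkℚᵘ (ℤ.+ ∣ a * suc D' - suc n' ∣) (D' + n' * suc D')
  ∣freq-invPow∣≃ b' k a n' D' D≡1+D' =
    ℚᵘP.≃-trans (ℚP.toℚᵘ-homo-∣-∣ (f ℚ.- L))
    (ℚᵘP.≃-trans (ℚᵘP.∣-∣-cong (ℚP.toℚᵘ-homo-+ f (ℚ.- L)))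
    (ℚᵘP.≃-trans (ℚᵘP.∣-∣-cong (ℚᵘP.+-cong (toℚᵘ-/ (ℤ.+ a) (suc n') n' refl)
                                  (ℚᵘP.≃-trans (ℚP.toℚᵘ-homo‿- L)
                                    (ℚᵘP.-‿cong (toℚᵘ-/ (ℤ.+ 1) (suc b' ^ k) {{m^n≢0 (suc b') k}} D' D≡1+D')))))
                 (ℚᵘP.≃-reflexive (∣a/n-1/D∣≡ a n' D'))))
    where
    f L : ℚ.ℚ
    f = ℤ.+ a ℚ./ suc n'
    L = invPow (suc b') k

  mkℚᵘ<⇒ : ∀ x m' s r' → ℚᵘ.mkℚᵘ (ℤ.+ x) m' ℚᵘ.< ℚᵘ.mkℚᵘ (ℤ.+ s) r' → x * suc r' < s * suc m'
  mkℚᵘ<⇒ x m' s r' (ℚᵘ.*<* lt) =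
    ℤP.drop‿+<+ (subst₂ ℤ._<_ (sym (ℤP.pos-* x (suc r'))) (sym (ℤP.pos-* s (suc m'))) lt)

  ⇒mkℚᵘ< : ∀ x m' s r' → x * suc r' < s * suc m' → ℚᵘ.mkℚᵘ (ℤ.+ x) m' ℚᵘ.< ℚᵘ.mkℚᵘ (ℤ.+ s) r'
  ⇒mkℚᵘ< x m' s r' lt = ℚᵘ.*<* (subst₂ ℤ._<_ (ℤP.pos-* x (suc r')) (ℤP.pos-* s (suc m')) (ℤ.+<+ lt))

module _ {b' : ℕ} (d : ℕ → Fin (suc b')) (c : List (Fin (suc b'))) where

  private
    k D D' : ℕ
    k = length c
    D = suc b' ^ k
    D' = proj₁ (nonZero⇒suc D {{m^n≢0 (suc b') k}})
    D≡1+D' : D ≡ suc D'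
    D≡1+D' = proj₂ (nonZero⇒suc D {{m^n≢0 (suc b') k}})

  ConvergesTo⇒HasDensity : ConvergesTo (freq d c) (invPow (suc b') k) → HasDensity (count d c) D
  ConvergesTo⇒HasDensity conv q = N , bound
    where
    E : ℕ
    E = suc q * D
    instance
      E≢0 : NonZero E
      E≢0 = m*n≢0 (suc q) D {{_}} {{m^n≢0 (suc b') k}}
    E' : ℕ
    E' = proj₁ (nonZero⇒suc E)
    E≡1+E' : E ≡ suc E'
    E≡1+E' = proj₂ (nonZero⇒suc E)
    ε : ℚ.ℚ
    ε = ℤ.+ 1 ℚ./ E
    N : ℕ
    N = proj₁ (conv ε (ℚP.normalize-pos 1 E))
    bound : ∀ n → N ≤ n → q * (D * count d c n) ≈[ n ] q * n
    bound zero    _   = ≈-reflexive 0 (cong (q *_) (*-zeroʳ D))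
    bound (suc n') N≤n = ∣-∣≤⇒≈ _ _ (begin
        ∣ q * (D * a) - q * n ∣   ≡⟨ sym (*-distribˡ-∣-∣ q (D * a) n) ⟩
        q * ∣ D * a - n ∣         ≡⟨ cong (λ z → q * ∣ z - n ∣) (trans (*-comm D a) (cong (a *_) D≡1+D')) ⟩
        q * dist                  ≤⟨ *-monoˡ-≤ dist (n≤1+n q) ⟩
        suc q * dist              ≤⟨ ≤-trans (≤-reflexive (*-comm (suc q) dist)) (<⇒≤ dist*[1+q]<n) ⟩
        n                         ∎)
      where
      open ≤-Reasoning
      n a dist : ℕ
      n = suc n'
      a = count d c n
      dist = ∣ a * suc D' - n ∣
      close : ℚᵘ.mkℚᵘ (ℤ.+ dist) (D' + n' * suc D') ℚᵘ.< ℚᵘ.mkℚᵘ (ℤ.+ 1) E'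
      close = ℚᵘP.<-respʳ-≃ (toℚᵘ-/ (ℤ.+ 1) E E' E≡1+E')
                (ℚᵘP.<-respˡ-≃ (∣freq-invPow∣≃ b' k a n' D' D≡1+D') (ℚP.toℚᵘ-mono-< (proj₂ (conv ε _) n N≤n)))
      dist*[1+q]<n : dist * suc q < n
      dist*[1+q]<n = *-cancelʳ-< D (dist * suc q) n (begin-strict
         dist * suc q * D            ≡⟨ *-assoc dist (suc q) D ⟩
         dist * E                    ≡⟨ cong (dist *_) E≡1+E' ⟩
         dist * suc E'               <⟨ mkℚᵘ<⇒ dist _ 1 E' close ⟩
         1 * suc (D' + n' * suc D')  ≡⟨ *-identityˡ _ ⟩
         n * suc D'                  ≡⟨ cong (n *_) (sym D≡1+D') ⟩
         n * D                       ∎)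

  HasDensity⇒ConvergesTo : HasDensity (count d c) D → ConvergesTo (freq d c) (invPow (suc b') k)
  HasDensity⇒ConvergesTo dens (ℚ.mkℚ +[1+ s' ] r' _) _ = suc N , bound
    where
    q N : ℕ
    q = 2 * suc r'
    N = proj₁ (dens q)
    bound : ∀ n → suc N ≤ n → ℚ.∣ freq d c n ℚ.- invPow (suc b') k ∣ ℚ.< ℚ.mkℚ +[1+ s' ] r' _
    bound (suc n') (s≤s N≤n') =
      ℚP.toℚᵘ-cancel-< (ℚᵘP.<-respˡ-≃ (ℚᵘP.≃-sym (∣freq-invPow∣≃ b' k a n' D' D≡1+D')) (⇒mkℚᵘ< dist _ (suc s') r' small))
      where
      open ≤-Reasoning
      n a dist : ℕ
      n = suc n'
      a = count d c n
      dist = ∣ a * suc D' - n ∣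
      q*dist≤n : q * dist ≤ n
      q*dist≤n = begin
        q * dist                 ≡⟨ cong (λ z → q * ∣ z - n ∣) (trans (cong (a *_) (sym D≡1+D')) (*-comm a D)) ⟩
        q * ∣ D * a - n ∣        ≡⟨ *-distribˡ-∣-∣ q (D * a) n ⟩
        ∣ q * (D * a) - q * n ∣  ≤⟨ ≈⇒∣-∣≤ _ _ (proj₂ (dens q) n (m≤n⇒m≤1+n N≤n')) ⟩
        n                        ∎
      dist*[1+r']<n : dist * suc r' < n
      dist*[1+r']<n with dist * suc r' in eq
      ... | zero  = s≤s z≤n
      ... | suc t = begin-strict
            suc t                  <⟨ m<m+n (suc t) (s≤s z≤n) ⟩
            suc t + suc t          ≡⟨ cong (suc t +_) (sym (+-identityʳ (suc t))) ⟩
            2 * suc t              ≡⟨ cong (2 *_) (sym eq) ⟩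
            2 * (dist * suc r')    ≡⟨ reassoc dist (suc r') ⟩
            q * dist               ≤⟨ q*dist≤n ⟩
            n                      ∎
        where
        reassoc : ∀ x y → 2 * (x * y) ≡ 2 * y * x
        reassoc = solve-∀
      small : dist * suc r' < suc s' * suc (D' + n' * suc D')
      small = begin-strict
        dist * suc r'                    <⟨ dist*[1+r']<n ⟩
        n                                ≤⟨ m≤m*n n (suc D') ⟩
        n * suc D'                       ≤⟨ m≤n*m (n * suc D') (suc s') ⟩
        suc s' * suc (D' + n' * suc D')  ∎

-- The selection rule as an automaton reading one digit per step: the state is the number of
-- digits still to be skipped, and a position is selected exactly when the state there is 0.

step : ℕ → ℕ → ℕ
step zero    d = d
step (suc s) d = s

run : ∀ {b} → ℕ → List (Fin b) → ℕ
run s []      = s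
run s (d ∷ w) = run (step s (toℕ d)) w

isZero : ℕ → Bool
isZero zero    = true
isZero (suc _) = false

-- If p is selected, the selected digits from p on begin with c.
parsesAt : ∀ {b} → (ℕ → Fin b) → List (Fin b) → ℕ → Bool
parsesAt x []       p = true
parsesAt x (c ∷ cs) p = ⌊ x p ≟ c ⌋ ∧ parsesAt x cs (p + 1 + toℕ c)

-- With x p = a (p + 1) and m₀ = n₁ − 1, sel i + 1 is the paper's n_(i+1) (see idx≡1+sel).
module Selection {b : ℕ} (x : ℕ → Fin b) (m₀ : ℕ) where

  state : ℕ → ℕ
  state zero    = m₀
  state (suc p) = step (state p) (toℕ (x p))

  sel : ℕ → ℕ
  sel zero    = m₀
  sel (suc i) = sel i + 1 + toℕ (x (sel i))

  selected : ℕ → Fin b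
  selected i = x (sel i)

  state-before-m₀ : ∀ p r → m₀ ≡ p + r → state p ≡ r
  state-before-m₀ zero    r m₀≡r = m₀≡r
  state-before-m₀ (suc p) r m₀≡1+p+r
    rewrite state-before-m₀ p (suc r) (trans m₀≡1+p+r (sym (+-suc p r))) = refl

  state-sel : ∀ i → state (sel i) ≡ 0
  state-after-sel : ∀ i t r → toℕ (x (sel i)) ≡ t + r → state (sel i + suc t) ≡ r

  state-sel zero    = state-before-m₀ m₀ 0 (sym (+-identityʳ m₀))
  state-sel (suc i) = trans (cong state (+-assoc (sel i) 1 _)) (state-after-sel i (toℕ (x (sel i))) 0 (sym (+-identityʳ _)))

  state-after-sel i zero    r xᵢ≡r rewrite +-suc (sel i) 0 | +-identityʳ (sel i) | state-sel i = xᵢ≡r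
  state-after-sel i (suc t) r xᵢ≡2+t+r
    rewrite +-suc (sel i) (suc t) | state-after-sel i t (suc r) (trans xᵢ≡2+t+r (sym (+-suc t r))) = refl

  state-window : ∀ p n → state (p + n) ≡ run (state p) (window x p n)
  state-window p zero    = cong state (+-identityʳ p)
  state-window p (suc n) = trans (cong state (+-suc p n)) (state-window (suc p) n)

  sumTo-state≡0 : ∀ (F : ℕ → ℕ) M → sumTo (λ p → 𝟙 (isZero (state p)) * F p) (sel M) ≡ sumTo (λ i → F (sel i)) M
  sumTo-state≡0 F zero = sumTo-zero m₀ unselected
    where
    unselected : ∀ p → p < m₀ → 𝟙 (isZero (state p)) * F p ≡ 0
    unselected p p<m₀ rewrite state-before-m₀ p (suc (m₀ ∸ suc p)) (sym (trans (+-suc p _) (m+[n∸m]≡n p<m₀))) = refl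
  sumTo-state≡0 F (suc M) = begin
    sumTo f (sel M + 1 + d)                                      ≡⟨ cong (sumTo f) (+-assoc (sel M) 1 d) ⟩
    sumTo f (sel M + (1 + d))                                    ≡⟨ sumTo-+-range f (sel M) (1 + d) ⟩
    sumTo f (sel M) + sumTo (λ i → f (sel M + i)) (1 + d)        ≡⟨ cong₂ _+_ (sumTo-state≡0 F M) (sumTo-+-range (λ i → f (sel M + i)) 1 d) ⟩
    sumTo (λ i → F (sel i)) M + (0 + f (sel M + 0) + sumTo (λ i → f (sel M + (1 + i))) d)
      ≡⟨ cong (λ z → sumTo (λ i → F (sel i)) M + z) (cong₂ _+_ at-sel skipped) ⟩
    sumTo (λ i → F (sel i)) M + (F (sel M) + 0)                  ≡⟨ cong (sumTo (λ i → F (sel i)) M +_) (+-identityʳ _) ⟩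
    sumTo (λ i → F (sel i)) M + F (sel M)                        ∎
    where
    open ≡-Reasoning
    f : ℕ → ℕ
    f p = 𝟙 (isZero (state p)) * F p
    d : ℕ
    d = toℕ (x (sel M))
    at-sel : 0 + f (sel M + 0) ≡ F (sel M)
    at-sel rewrite +-identityʳ (sel M) | state-sel M = +-identityʳ _
    skipped : sumTo (λ i → f (sel M + (1 + i))) d ≡ 0
    skipped = sumTo-zero d unselected
      where
      unselected : ∀ i → i < d → f (sel M + (1 + i)) ≡ 0
      unselected i i<d rewrite state-after-sel M i (suc (d ∸ suc i)) (sym (trans (+-suc i _) (m+[n∸m]≡n i<d))) = refl

  occursAt-selected : ∀ c i → occursAt selected i c ≡ parsesAt x c (sel i)
  occursAt-selected []       i = refl
  occursAt-selected (c ∷ cs) i with x (sel i) ≟ c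
  ... | yes xᵢ≡c rewrite occursAt-selected cs (suc i) | xᵢ≡c = refl
  ... | no  _    = refl

  count-selected : ∀ c M → count selected c M ≡ sumTo (λ p → 𝟙 (isZero (state p)) * 𝟙 (parsesAt x c p)) (sel M)
  count-selected c M = begin
    count selected c M                                ≡⟨ count≡sumTo-occursAt selected c M ⟩
    sumTo (λ i → 𝟙 (occursAt selected i c)) M         ≡⟨ sumTo-cong M (λ i _ → cong 𝟙 (occursAt-selected c i)) ⟩
    sumTo (λ i → 𝟙 (parsesAt x c (sel i))) M          ≡⟨ sym (sumTo-state≡0 (λ p → 𝟙 (parsesAt x c p)) M) ⟩
    sumTo (λ p → 𝟙 (isZero (state p)) * 𝟙 (parsesAt x c p)) (sel M) ∎
    where open ≡-Reasoning

  M≡sumTo-state≡0 : ∀ M → M ≡ sumTo (λ p → 𝟙 (isZero (state p)) * 1) (sel M)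
  M≡sumTo-state≡0 M = sym (trans (sumTo-state≡0 (λ _ → 1) M) (trans (sumTo-const 1 M) (*-identityʳ M)))

idx≡1+sel : ∀ {b} (a : ℕ → Fin b) m₀ i → idx a (suc m₀) i ≡ suc (Selection.sel (λ i → a (suc i)) m₀ i)
idx≡1+sel a m₀ zero    = refl
idx≡1+sel a m₀ (suc i) rewrite idx≡1+sel a m₀ i = refl

parses : ∀ {b} → List (Fin b) → List (Fin b) → Bool
parses []       w       = true
parses (c ∷ cs) []      = false
parses (c ∷ cs) (d ∷ w) = ⌊ d ≟ c ⌋ ∧ parses cs (drop (toℕ c) w)

span : ∀ {b} → List (Fin b) → ℕ
span []       = 0
span (c ∷ cs) = suc (toℕ c + span cs)

span≤ : ∀ {b} (c : List (Fin b)) → span c ≤ length c * b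
span≤ []             = z≤n
span≤ {b} (c ∷ cs) = begin
  suc (toℕ c + span cs)           ≤⟨ s≤s (+-monoʳ-≤ (toℕ c) (span≤ cs)) ⟩
  suc (toℕ c) + length cs * b     ≤⟨ +-monoˡ-≤ (length cs * b) (toℕ<n c) ⟩
  b + length cs * b               ∎
  where open ≤-Reasoning

span-∷-≤ : ∀ {b} (c : Fin b) cs {R} → span (c ∷ cs) ≤ suc R → toℕ c ≤ R × span cs ≤ R ∸ toℕ c
span-∷-≤ c cs (s≤s c+span≤R) =
  ≤-trans (m≤m+n (toℕ c) (span cs)) c+span≤R ,
  ≤-trans (≤-reflexive (sym (m+n∸m≡n (toℕ c) (span cs)))) (∸-monoˡ-≤ (toℕ c) c+span≤R)

parsesAt-window : ∀ {b} (x : ℕ → Fin b) c p R → span c ≤ R → parsesAt x c p ≡ parses c (window x p R)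
parsesAt-window x []       p R       _        = refl
parsesAt-window x (c ∷ cs) p (suc R) span≤1+R with span-∷-≤ c cs span≤1+R
... | c≤R , span-cs≤ = cong (⌊ x p ≟ c ⌋ ∧_) (begin
  parsesAt x cs (p + 1 + toℕ c)                            ≡⟨ parsesAt-window x cs _ (R ∸ toℕ c) span-cs≤ ⟩
  parses cs (window x (p + 1 + toℕ c) (R ∸ toℕ c))         ≡⟨ cong (λ q → parses cs (window x (q + toℕ c) (R ∸ toℕ c))) (+-comm p 1) ⟩
  parses cs (window x (suc p + toℕ c) (R ∸ toℕ c))         ≡⟨ cong (parses cs) (sym (drop-window x (toℕ c) (suc p) (R ∸ toℕ c))) ⟩
  parses cs (drop (toℕ c) (window x (suc p) (toℕ c + (R ∸ toℕ c)))) ≡⟨ cong (λ n → parses cs (drop (toℕ c) (window x (suc p) n))) (m+[n∸m]≡n c≤R) ⟩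
  parses cs (drop (toℕ c) (window x (suc p) R))            ∎)
  where
  open ≡-Reasoning

sumWords-parses : ∀ b (c : List (Fin b)) R → span c ≤ R → b ^ length c * sumWords b R (λ w → 𝟙 (parses c w)) ≡ b ^ R
sumWords-parses b []       R _ = trans (+-identityʳ _) (trans (sumWords-const b R 1) (*-identityʳ _))
sumWords-parses b (c ∷ cs) (suc R) span≤1+R with span-∷-≤ c cs span≤1+R
... | c≤R , span-cs≤ = begin
  b * b ^ k * sumFin b (λ d → sumWords b R (λ w → 𝟙 (⌊ d ≟ c ⌋ ∧ rest w)))
    ≡⟨ cong (b * b ^ k *_) (sumFin-cong b (λ d → trans (sumWords-cong b R (λ w _ → 𝟙-∧ ⌊ d ≟ c ⌋ _))
                                                       (sumWords-*ˡ b R (𝟙 ⌊ d ≟ c ⌋) _))) ⟩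
  b * b ^ k * sumFin b (λ d → 𝟙 ⌊ d ≟ c ⌋ * sumWords b R (λ w → 𝟙 (rest w)))
    ≡⟨ cong (b * b ^ k *_) (sumFin-selectʳ b c (λ _ → sumWords b R (λ w → 𝟙 (rest w)))) ⟩
  b * b ^ k * sumWords b R (λ w → 𝟙 (rest w))
    ≡⟨ cong (λ n → b * b ^ k * sumWords b n (λ w → 𝟙 (rest w))) (sym (m+[n∸m]≡n c≤R)) ⟩
  b * b ^ k * sumWords b (toℕ c + (R ∸ toℕ c)) (λ w → 𝟙 (rest w))
    ≡⟨ cong (b * b ^ k *_) (sumWords-drop b (toℕ c) (R ∸ toℕ c) (λ w → 𝟙 (parses cs w))) ⟩
  b * b ^ k * (b ^ toℕ c * sumWords b (R ∸ toℕ c) (λ w → 𝟙 (parses cs w)))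
    ≡⟨ swap b (b ^ k) (b ^ toℕ c) _ ⟩
  b * b ^ toℕ c * (b ^ k * sumWords b (R ∸ toℕ c) (λ w → 𝟙 (parses cs w)))
    ≡⟨ cong (b * b ^ toℕ c *_) (sumWords-parses b cs (R ∸ toℕ c) span-cs≤) ⟩
  b * b ^ toℕ c * b ^ (R ∸ toℕ c)
    ≡⟨ trans (*-assoc b _ _) (cong (b *_) (sym (^-distribˡ-+-* b (toℕ c) _))) ⟩
  b * b ^ (toℕ c + (R ∸ toℕ c))
    ≡⟨ cong (λ n → b * b ^ n) (m+[n∸m]≡n c≤R) ⟩
  b * b ^ R ∎
  where
  open ≡-Reasoning
  k = length cs
  rest : List (Fin b) → Bool
  rest w = parses cs (drop (toℕ c) w)
  swap : ∀ a p q s → a * p * (q * s) ≡ a * q * (p * s)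
  swap = solve-∀

-- Synchronisation: after t zeros every state s ≤ t has dropped to 0, so a word containing
-- an aligned block of t zeros drives all states s ≤ t to the same final state.

isZeroDigit : ∀ {n} → Fin n → Bool
isZeroDigit zero    = true
isZeroDigit (suc _) = false

zerosPrefix : ∀ {b} → ℕ → List (Fin b) → Bool
zerosPrefix zero    u       = true
zerosPrefix (suc t) []      = false
zerosPrefix (suc t) (d ∷ u) = isZeroDigit d ∧ zerosPrefix t u

hasZeroBlock : ∀ {b} → ℕ → ℕ → List (Fin b) → Bool
hasZeroBlock t zero    u = false
hasZeroBlock t (suc j) u = zerosPrefix t u ∨ hasZeroBlock t j (drop t u)

run-++ : ∀ {b} s (u v : List (Fin b)) → run s (u ++ v) ≡ run (run s u) v
run-++ s []      v = refl
run-++ s (d ∷ u) v = run-++ (step s (toℕ d)) u v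

run-take-drop : ∀ {b} n s (u : List (Fin b)) → run s u ≡ run (run s (take n u)) (drop n u)
run-take-drop n s u = trans (cong (run s) (sym (take++drop≡id n u))) (run-++ s (take n u) (drop n u))

step-≤ : ∀ t s d → s ≤ t → d ≤ t → step s d ≤ t
step-≤ t zero    d _   d≤t = d≤t
step-≤ t (suc s) d s≤t _   = ≤-trans (n≤1+n s) s≤t

run-≤ : ∀ t s (u : List (Fin (suc t))) → s ≤ t → run s u ≤ t
run-≤ t s []      s≤t = s≤t
run-≤ t s (d ∷ u) s≤t = run-≤ t _ u (step-≤ t s (toℕ d) s≤t (toℕ≤pred[n] d))

run-zerosPrefix : ∀ {b} t (u : List (Fin b)) s → zerosPrefix t u ≡ true → run s (take t u) ≡ s ∸ t
run-zerosPrefix zero    u          s _     = refl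
run-zerosPrefix (suc t) (zero ∷ u) s zeros = trans (run-zerosPrefix t u (step s 0) zeros) (step0∸ s)
  where
  step0∸ : ∀ s → step s 0 ∸ t ≡ s ∸ suc t
  step0∸ zero    = 0∸n≡0 t
  step0∸ (suc s) = refl

run-synchronises : ∀ t j (u : List (Fin (suc t))) s → s ≤ t → hasZeroBlock t j u ≡ true → run s u ≡ run 0 u
run-synchronises t (suc j) u s s≤t hasBlock with zerosPrefix t u in zeros
... | true  = begin
  run s u                           ≡⟨ run-take-drop t s u ⟩
  run (run s (take t u)) (drop t u) ≡⟨ cong (λ r → run r (drop t u)) (trans (run-zerosPrefix t u s zeros) (m≤n⇒m∸n≡0 s≤t)) ⟩
  run 0 (drop t u)                  ≡⟨ cong (λ r → run r (drop t u)) (sym (trans (run-zerosPrefix t u 0 zeros) (0∸n≡0 t))) ⟩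
  run (run 0 (take t u)) (drop t u) ≡⟨ sym (run-take-drop t 0 u) ⟩
  run 0 u                           ∎
  where open ≡-Reasoning
... | false = begin
  run s u                           ≡⟨ run-take-drop t s u ⟩
  run (run s (take t u)) (drop t u) ≡⟨ run-synchronises t j (drop t u) _ (run-≤ t s (take t u) s≤t) hasBlock ⟩
  run 0 (drop t u)                  ≡⟨ sym (run-synchronises t j (drop t u) _ (run-≤ t 0 (take t u) z≤n) hasBlock) ⟩
  run (run 0 (take t u)) (drop t u) ≡⟨ sym (run-take-drop t 0 u) ⟩
  run 0 u                           ∎
  where open ≡-Reasoning

zerosPrefix-++ : ∀ {b} t (z v : List (Fin b)) → length z ≡ t → zerosPrefix t (z ++ v) ≡ zerosPrefix t z
zerosPrefix-++ zero    []      v _       = refl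
zerosPrefix-++ (suc t) (d ∷ z) v ∣z∣≡1+t = cong (isZeroDigit d ∧_) (zerosPrefix-++ t z v (suc-injective ∣z∣≡1+t))

sumWords-zerosPrefix : ∀ t n → sumWords (suc t) n (λ w → 𝟙 (zerosPrefix n w)) ≡ 1
sumWords-zerosPrefix t zero    = refl
sumWords-zerosPrefix t (suc n) = trans (cong₂ _+_ (sumWords-zerosPrefix t n) nonzero-first) (+-identityʳ 1)
  where
  nonzero-first : sumFin t (λ d → sumWords (suc t) n (λ _ → 0)) ≡ 0
  nonzero-first = trans (sumFin-cong t (λ d → trans (sumWords-const (suc t) n 0) (*-zeroʳ (suc t ^ n))))
                        (trans (sumFin-const t 0) (*-zeroʳ t))

sumWords-not-zerosPrefix : ∀ t n → sumWords (suc t) n (λ w → 𝟙 (not (zerosPrefix n w))) ≡ suc t ^ n ∸ 1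
sumWords-not-zerosPrefix t n = begin
  S                                          ≡⟨ sym (m+n∸n≡m S 1) ⟩
  S + 1 ∸ 1                                  ≡⟨ cong (λ z → S + z ∸ 1) (sym (sumWords-zerosPrefix t n)) ⟩
  S + sumWords (suc t) n (λ w → 𝟙 (zerosPrefix n w)) ∸ 1
    ≡⟨ cong (_∸ 1) (sym (sumWords-+ (suc t) n _ _)) ⟩
  sumWords (suc t) n (λ w → 𝟙 (not (zerosPrefix n w)) + 𝟙 (zerosPrefix n w)) ∸ 1
    ≡⟨ cong (_∸ 1) (sumWords-cong (suc t) n (λ w _ → 𝟙-not+𝟙 (zerosPrefix n w))) ⟩
  sumWords (suc t) n (λ _ → 1) ∸ 1           ≡⟨ cong (_∸ 1) (trans (sumWords-const (suc t) n 1) (*-identityʳ (suc t ^ n))) ⟩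
  suc t ^ n ∸ 1                              ∎
  where
  open ≡-Reasoning
  S : ℕ
  S = sumWords (suc t) n (λ w → 𝟙 (not (zerosPrefix n w)))

sumWords-not-hasZeroBlock : ∀ t j → sumWords (suc t) (j * t) (λ u → 𝟙 (not (hasZeroBlock t j u))) ≡ (suc t ^ t ∸ 1) ^ j
sumWords-not-hasZeroBlock t zero    = refl
sumWords-not-hasZeroBlock t (suc j) = begin
  sumWords b (t + j * t) (λ u → 𝟙 (not (hasZeroBlock t (suc j) u)))
    ≡⟨ sumWords-++ b t (j * t) _ ⟩
  sumWords b t (λ z → sumWords b (j * t) (λ v → 𝟙 (not (hasZeroBlock t (suc j) (z ++ v)))))
    ≡⟨ sumWords-cong b t (λ z ∣z∣≡t → sumWords-cong b (j * t) (λ v _ →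
         trans (cong (λ w → 𝟙 (not w)) (cong₂ _∨_ (zerosPrefix-++ t z v ∣z∣≡t) (cong (hasZeroBlock t j) (drop-++ t z v ∣z∣≡t))))
               (𝟙-not-∨ (zerosPrefix t z) (hasZeroBlock t j v)))) ⟩
  sumWords b t (λ z → sumWords b (j * t) (λ v → 𝟙 (not (zerosPrefix t z)) * 𝟙 (not (hasZeroBlock t j v))))
    ≡⟨ sumWords-cong b t (λ z _ → sumWords-*ˡ b (j * t) (𝟙 (not (zerosPrefix t z))) _) ⟩
  sumWords b t (λ z → 𝟙 (not (zerosPrefix t z)) * B)
    ≡⟨ sumWords-*ʳ b t B (λ z → 𝟙 (not (zerosPrefix t z))) ⟩
  sumWords b t (λ z → 𝟙 (not (zerosPrefix t z))) * B
    ≡⟨ cong₂ _*_ (sumWords-not-zerosPrefix t t) (sumWords-not-hasZeroBlock t j) ⟩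
  (b ^ t ∸ 1) * (b ^ t ∸ 1) ^ j ∎
  where
  open ≡-Reasoning
  b B : ℕ
  b = suc t
  B = sumWords b (j * t) (λ v → 𝟙 (not (hasZeroBlock t j v)))

bernoulli : ∀ a j → a ^ j * (a + j) ≤ a * suc a ^ j
bernoulli a zero    = ≤-reflexive (trans (+-identityʳ _) (trans (+-identityʳ a) (sym (*-identityʳ a))))
bernoulli a (suc j) = begin
  a * a ^ j * (a + suc j)                  ≡⟨ expand a (a ^ j) j ⟩
  a * (a ^ j * (a + j)) + a ^ j * a        ≤⟨ +-monoʳ-≤ (a * (a ^ j * (a + j))) (*-monoʳ-≤ (a ^ j) (m≤m+n a j)) ⟩
  a * (a ^ j * (a + j)) + a ^ j * (a + j)  ≡⟨ +-comm (a * (a ^ j * (a + j))) _ ⟩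
  suc a * (a ^ j * (a + j))                ≤⟨ *-monoʳ-≤ (suc a) (bernoulli a j) ⟩
  suc a * (a * suc a ^ j)                  ≡⟨ swap a (suc a ^ j) ⟩
  a * (suc a * suc a ^ j)                  ∎
  where
  open ≤-Reasoning
  expand : ∀ a p j → a * p * (a + suc j) ≡ a * (p * (a + j)) + p * a
  expand = solve-∀
  swap : ∀ a p → suc a * (a * p) ≡ a * (suc a * p)
  swap = solve-∀

*^-≤-suc^ : ∀ C a → 1 ≤ a → C * a ^ (C * a) ≤ suc a ^ (C * a)
*^-≤-suc^ C a@(suc _) _ = *-cancelˡ-≤ a (begin
  a * (C * a ^ n)   ≡⟨ swap a C (a ^ n) ⟩
  a ^ n * (C * a)   ≤⟨ *-monoʳ-≤ (a ^ n) (m≤n+m (C * a) a) ⟩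
  a ^ n * (a + n)   ≤⟨ bernoulli a n ⟩
  a * suc a ^ n     ∎)
  where
  open ≤-Reasoning
  n : ℕ
  n = C * a
  swap : ∀ a c p → a * (c * p) ≡ p * (c * a)
  swap = solve-∀

-- Among the words of length j·t, those with no zero block form a fraction ((b^t − 1)/b^t)^j,
-- which for j = C·(b^t − 1) is at most 1/C.
unsynced-rare : ∀ t C R → 1 ≤ t →
  let A = suc t ^ t ∸ 1 in C * (A ^ (C * A) * suc t ^ R) ≤ suc t ^ (C * A * t + R)
unsynced-rare t C R 1≤t = begin
  C * (A ^ j * b ^ R)     ≡⟨ sym (*-assoc C (A ^ j) (b ^ R)) ⟩
  C * A ^ j * b ^ R       ≤⟨ *-monoˡ-≤ (b ^ R) (*^-≤-suc^ C A 1≤A) ⟩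
  suc A ^ j * b ^ R       ≡⟨ cong (λ z → z ^ j * b ^ R) 1+A≡b^t ⟩
  (b ^ t) ^ j * b ^ R     ≡⟨ cong (_* b ^ R) (trans (^-*-assoc b t j) (cong (b ^_) (*-comm t j))) ⟩
  b ^ (j * t) * b ^ R     ≡⟨ sym (^-distribˡ-+-* b (j * t) R) ⟩
  b ^ (j * t + R)         ∎
  where
  open ≤-Reasoning
  b A j : ℕ
  b = suc t
  A = b ^ t ∸ 1
  j = C * A
  b≤b^t : b ≤ b ^ t
  b≤b^t = ≤-trans (≤-reflexive (sym (*-identityʳ b))) (^-monoʳ-≤ b 1≤t)
  1≤A : 1 ≤ A
  1≤A = ∸-monoˡ-≤ 1 (≤-trans (s≤s 1≤t) b≤b^t)
  1+A≡b^t : suc A ≡ b ^ t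
  1+A≡b^t = trans (+-comm 1 A) (m∸n+n≡m (m^n>0 b t))

eventually-∀Fin : ∀ m (F : Fin m → ℕ → Set) → (∀ d → ∃ λ N → ∀ n → N ≤ n → F d n) →
                  ∃ λ N → ∀ d n → N ≤ n → F d n
eventually-∀Fin zero    F ev = 0 , λ ()
eventually-∀Fin (suc m) F ev = N₀ ⊔ N₁ , λ
  { zero    n N≤n → proj₂ (ev zero) n (≤-trans (m≤m⊔n N₀ N₁) N≤n)
  ; (suc d) n N≤n → proj₂ rest d n (≤-trans (m≤n⊔m N₀ N₁) N≤n) }
  where
  N₀ N₁ : ℕ
  N₀ = proj₁ (ev zero)
  rest : ∃ λ N → ∀ d n → N ≤ n → F (suc d) n
  rest = eventually-∀Fin m (λ d → F (suc d)) (λ d → ev (suc d))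
  N₁ = proj₁ rest

eventually-∀words : ∀ b n (F : List (Fin b) → ℕ → Set) →
                    (∀ w → length w ≡ n → ∃ λ N → ∀ P → N ≤ P → F w P) →
                    ∃ λ N → ∀ w → length w ≡ n → ∀ P → N ≤ P → F w P
eventually-∀words b zero    F ev = proj₁ (ev [] refl) , λ { [] _ P N≤P → proj₂ (ev [] refl) P N≤P }
eventually-∀words b (suc n) F ev =
  proj₁ byFirst , λ { (d ∷ w) ∣dw∣≡1+n P N≤P → proj₂ byFirst d P N≤P w (suc-injective ∣dw∣≡1+n) P ≤-refl }
  where
  byFirst : ∃ λ N → ∀ d N′ → N ≤ N′ → ∀ w → length w ≡ n → ∀ P → N′ ≤ P → F (d ∷ w) P
  byFirst = eventually-∀Fin b (λ d N → ∀ w → length w ≡ n → ∀ P → N ≤ P → F (d ∷ w) P)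
    (λ d → let ev-d = eventually-∀words b n (λ w → F (d ∷ w)) (λ w ∣w∣≡n → ev (d ∷ w) (cong suc ∣w∣≡n)) in
           proj₁ ev-d , λ N N₀≤N w ∣w∣≡n P N≤P → proj₂ ev-d w ∣w∣≡n P (≤-trans N₀≤N N≤P))

DensitiesAt : ∀ {b} → (ℕ → Fin b) → ℕ → ℕ → ℕ → Set
DensitiesAt {b} x W q P = ∀ w → length w ≡ W → q * (b ^ W * count x w P) ≈[ P ] q * P

normal⇒DensitiesAt : ∀ {t} (x : ℕ → Fin (suc t)) → Normal (suc t) x → ∀ W → 1 ≤ W → ∀ q →
                     ∃ λ N → ∀ P → N ≤ P → DensitiesAt x W q P
normal⇒DensitiesAt {t} x normal W 1≤W q with eventually-∀words (suc t) W _ density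
  where
  density : ∀ w → length w ≡ W → ∃ λ N → ∀ P → N ≤ P → q * (suc t ^ W * count x w P) ≈[ P ] q * P
  density w refl = ConvergesTo⇒HasDensity x w (normal w 1≤W) q
... | N , uniform = N , λ P N≤P w ∣w∣≡W → uniform w ∣w∣≡W P N≤P

sumTo-window-≈ : ∀ {b} (x : ℕ → Fin b) W q P (g : List (Fin b) → ℕ) → DensitiesAt x W q P →
  q * (b ^ W * sumTo (λ i → g (window x i W)) P) ≈[ sumWords b W g * P ] q * (sumWords b W g * P)
sumTo-window-≈ {b} x W q P g dens =
  ≈-respˡ lhs (≈-resp-error error (≈-respʳ rhs
    (sumWords-≈ b W {e = λ w → g w * P} (λ w ∣w∣≡W → ≈-*ˡ (g w) (dens w ∣w∣≡W)))))
  where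
  B : ℕ
  B = b ^ W
  reassoc : ∀ g q B n → g * (q * (B * n)) ≡ q * B * (g * n)
  reassoc = solve-∀
  lhs : sumWords b W (λ w → g w * (q * (B * count x w P))) ≡ q * (B * sumTo (λ i → g (window x i W)) P)
  lhs = trans (sumWords-cong b W (λ w _ → reassoc (g w) q B (count x w P)))
          (trans (sumWords-*ˡ b W (q * B) (λ w → g w * count x w P))
            (trans (*-assoc q B _) (cong (λ n → q * (B * n)) (sumWords-*count x W g P))))
  error : sumWords b W (λ w → g w * P) ≡ sumWords b W g * P
  error = sumWords-*ʳ b W P g
  rhs : sumWords b W (λ w → g w * (q * P)) ≡ q * (sumWords b W g * P)
  rhs = trans (sumWords-*ʳ b W (q * P) g) (reassoc′ (sumWords b W g) q P)
    where
    reassoc′ : ∀ s q P → s * (q * P) ≡ q * (s * P)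
    reassoc′ = solve-∀

module _ {t : ℕ} (x : ℕ → Fin (suc t)) (m₀ : ℕ) where
  open Selection x m₀

  state-≤ : ∀ n → state (m₀ + n) ≤ t
  state-≤ zero    = ≤-trans (≤-reflexive (trans (cong state (+-identityʳ m₀)) (state-before-m₀ m₀ 0 (sym (+-identityʳ m₀))))) z≤n
  state-≤ (suc n) rewrite +-suc m₀ n = step-≤ t (state (m₀ + n)) _ (state-≤ n) (toℕ≤pred[n] (x (m₀ + n)))

  n≤sel : ∀ n → n ≤ sel n
  n≤sel zero    = z≤n
  n≤sel (suc n) = ≤-trans (s≤s (n≤sel n)) (≤-trans (≤-reflexive (+-comm 1 (sel n))) (m≤m+n (sel n + 1) _))

  sel≤ : ∀ n → sel n ≤ m₀ + n * suc t
  sel≤ zero    = ≤-reflexive (sym (+-identityʳ m₀))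
  sel≤ (suc n) = begin
    sel n + 1 + toℕ (x (sel n))   ≤⟨ +-monoʳ-≤ (sel n + 1) (toℕ≤pred[n] (x (sel n))) ⟩
    sel n + 1 + t                 ≡⟨ +-assoc (sel n) 1 t ⟩
    sel n + suc t                 ≤⟨ +-monoˡ-≤ (suc t) (sel≤ n) ⟩
    m₀ + n * suc t + suc t        ≡⟨ reassoc m₀ n (suc t) ⟩
    m₀ + suc n * suc t            ∎
    where
    open ≤-Reasoning
    reassoc : ∀ a m b → a + m * b + b ≡ a + (b + m * b)
    reassoc = solve-∀

-- Whether position i + L is selected, and what the parse from there reads, is decided by the
-- window of length W = L + R at i, unless its first L digits fail to synchronise or i < m₀.
module Windows (t : ℕ) (x : ℕ → Fin (suc t)) (m₀ j R : ℕ) where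
  open Selection x m₀

  b L W : ℕ
  b = suc t
  L = j * t
  W = L + R

  synced : List (Fin b) → Bool
  synced = hasZeroBlock t j

  syncedSelecting : List (Fin b) → ℕ
  syncedSelecting u = 𝟙 (synced u) * 𝟙 (isZero (run 0 u))

  weight : (List (Fin b) → Bool) → List (Fin b) → ℕ
  weight F w = syncedSelecting (take L w) * 𝟙 (F (drop L w))

  unsynced : List (Fin b) → ℕ
  unsynced w = 𝟙 (not (synced (take L w)))

  unsyncedCount : ℕ → ℕ
  unsyncedCount P = sumTo (λ i → unsynced (window x i W)) P

  selectedCount : (ℕ → Bool) → ℕ → ℕ
  selectedCount F P = sumTo (λ p → 𝟙 (isZero (state p)) * 𝟙 (F p)) P

  weightCount : (List (Fin b) → Bool) → ℕ → ℕ
  weightCount Fw P = sumTo (λ i → weight Fw (window x i W)) P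

  syncedSelecting≤1 : ∀ u → syncedSelecting u ≤ 1
  syncedSelecting≤1 u = 𝟙*≤1 (synced u) (𝟙≤1 _)

  selected≈weight : ∀ (F : ℕ → Bool) Fw → (∀ p → F p ≡ Fw (window x p R)) → ∀ i →
    𝟙 (isZero (state (i + L))) * 𝟙 (F (i + L)) ≈[ unsynced (window x i W) + 𝟙 (i <ᵇ m₀) ] weight Fw (window x i W)
  selected≈weight F Fw F≡Fw i with i <ᵇ m₀ in i<ᵇm₀
  ... | true  = ≈-weaken (m≤n+m 1 _)
                  (≤1⇒≈[1] (𝟙*≤1 (isZero (state (i + L))) (𝟙≤1 _))
                           (≤-trans (*-monoˡ-≤ _ (syncedSelecting≤1 _)) (≤-trans (≤-reflexive (+-identityʳ _)) (𝟙≤1 _))))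
  ... | false = ≈-weaken (m≤m+n _ 0) byWindow
    where
    u v : List (Fin b)
    u = window x i L
    v = window x (i + L) R
    state≤t : state i ≤ t
    state≤t = subst (λ p → state p ≤ t) (m+[n∸m]≡n m₀≤i) (state-≤ x m₀ (i ∸ m₀))
      where
      m₀≤i : m₀ ≤ i
      m₀≤i = ≮⇒≥ (λ i<m₀ → subst T i<ᵇm₀ (<⇒<ᵇ i<m₀))
    byWindow : 𝟙 (isZero (state (i + L))) * 𝟙 (F (i + L)) ≈[ unsynced (window x i W) ] weight Fw (window x i W)
    byWindow rewrite take-window x L i R | drop-window x L i R | state-window i L | F≡Fw (i + L)
      with synced u in isSynced
    ... | true  rewrite run-synchronises t j u (state i) state≤t isSynced =
      ≈-reflexive 0 (cong (_* 𝟙 (Fw v)) (sym (+-identityʳ (𝟙 (isZero (run 0 u))))))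
    ... | false = ≤1⇒≈[1] (𝟙*≤1 (isZero (run (state i) u)) (𝟙≤1 _)) z≤n

  selectedCount≈weightCount : ∀ F Fw → (∀ p → F p ≡ Fw (window x p R)) →
    ∀ P → selectedCount F P ≈[ L + (unsyncedCount P + m₀) ] weightCount Fw P
  selectedCount≈weightCount F Fw F≡Fw P =
    ≈-trans (sumTo-shift-≈ (λ p → 𝟙 (isZero (state p)) * 𝟙 (F p)) L P (λ p → 𝟙*≤1 (isZero (state p)) (𝟙≤1 _)))
            (≈-weaken (≤-trans (≤-reflexive (sumTo-+ (λ i → unsynced (window x i W)) (λ i → 𝟙 (i <ᵇ m₀)) P))
                               (+-monoʳ-≤ (unsyncedCount P) (sumTo-<ᵇ≤ m₀ P)))
                      (sumTo-≈ P (selected≈weight F Fw F≡Fw)))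

  sumWords-weight : ∀ Fw → sumWords b W (weight Fw) ≡ sumWords b L syncedSelecting * sumWords b R (λ v → 𝟙 (Fw v))
  sumWords-weight Fw = begin
    sumWords b W (weight Fw)
      ≡⟨ sumWords-++ b L R (weight Fw) ⟩
    sumWords b L (λ u → sumWords b R (λ v → weight Fw (u ++ v)))
      ≡⟨ sumWords-cong b L (λ u ∣u∣≡L → sumWords-cong b R (λ v _ →
           cong₂ (λ s r → syncedSelecting s * 𝟙 (Fw r)) (take-++ L u v ∣u∣≡L) (drop-++ L u v ∣u∣≡L))) ⟩
    sumWords b L (λ u → sumWords b R (λ v → syncedSelecting u * 𝟙 (Fw v)))
      ≡⟨ sumWords-cong b L (λ u _ → sumWords-*ˡ b R (syncedSelecting u) (λ v → 𝟙 (Fw v))) ⟩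
    sumWords b L (λ u → syncedSelecting u * sumWords b R (λ v → 𝟙 (Fw v)))
      ≡⟨ sumWords-*ʳ b L _ syncedSelecting ⟩
    sumWords b L syncedSelecting * sumWords b R (λ v → 𝟙 (Fw v)) ∎
    where open ≡-Reasoning

  sumWords-unsynced : sumWords b W unsynced ≡ (b ^ t ∸ 1) ^ j * b ^ R
  sumWords-unsynced = begin
    sumWords b W unsynced
      ≡⟨ sumWords-++ b L R unsynced ⟩
    sumWords b L (λ u → sumWords b R (λ v → unsynced (u ++ v)))
      ≡⟨ sumWords-cong b L (λ u ∣u∣≡L → trans (sumWords-cong b R (λ v _ → cong (λ s → 𝟙 (not (synced s))) (take-++ L u v ∣u∣≡L)))
                                             (sumWords-const b R _)) ⟩
    sumWords b L (λ u → b ^ R * 𝟙 (not (synced u)))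
      ≡⟨ sumWords-*ˡ b L (b ^ R) _ ⟩
    b ^ R * sumWords b L (λ u → 𝟙 (not (synced u)))
      ≡⟨ *-comm (b ^ R) _ ⟩
    sumWords b L (λ u → 𝟙 (not (synced u))) * b ^ R
      ≡⟨ cong (_* b ^ R) (sumWords-not-hasZeroBlock t j) ⟩
    (b ^ t ∸ 1) ^ j * b ^ R ∎
    where open ≡-Reasoning

  sumWords-weight-all≤ : sumWords b W (weight (λ _ → true)) ≤ b ^ W
  sumWords-weight-all≤ = ≤-trans (sumWords-mono-≤ b W (λ w _ → *-monoˡ-≤ 1 (syncedSelecting≤1 _)))
                                 (≤-reflexive (trans (sumWords-const b W 1) (*-identityʳ _)))

  sumWords-weight-parses : ∀ c → span c ≤ R → b ^ length c * sumWords b W (weight (parses c)) ≡ sumWords b W (weight (λ _ → true))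
  sumWords-weight-parses c span≤R = begin
    b ^ length c * sumWords b W (weight (parses c))            ≡⟨ cong (b ^ length c *_) (sumWords-weight (parses c)) ⟩
    b ^ length c * (S * sumWords b R (λ v → 𝟙 (parses c v)))   ≡⟨ x*[y*z]≡y*[x*z] (b ^ length c) S _ ⟩
    S * (b ^ length c * sumWords b R (λ v → 𝟙 (parses c v)))   ≡⟨ cong (S *_) (sumWords-parses b c R span≤R) ⟩
    S * b ^ R                                                  ≡⟨ cong (S *_) (sym (trans (sumWords-const b R 1) (*-identityʳ _))) ⟩
    S * sumWords b R (λ _ → 1)                                 ≡⟨ sym (sumWords-weight (λ _ → true)) ⟩
    sumWords b W (weight (λ _ → true))                         ∎
    where
    open ≡-Reasoning
    S : ℕ
    S = sumWords b L syncedSelecting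
    x*[y*z]≡y*[x*z] : ∀ x y z → x * (y * z) ≡ y * (x * z)
    x*[y*z]≡y*[x*z] = solve-∀

  windowError : ℕ → ℕ
  windowError P = L + (unsyncedCount P + m₀)

  -- With X = q·b^W, H the total weight and P = sel M:  X·b^k·(count of c among the first M
  -- selected digits)  ≈  X·b^k·(weighted window count)  ≈  q·H·P  ≈  X·(windows count)  ≈  X·M.
  count-selected-≈ : ∀ c → span c ≤ R → ∀ q M → DensitiesAt x W q (sel M) →
    let P = sel M
        X = q * b ^ W
        H = sumWords b W (weight (λ _ → true))
    in X * (b ^ length c * count selected c M) ≈[ X * (b ^ length c * windowError P) + H * P + H * P + X * windowError P ] X * M
  count-selected-≈ c span≤R q M dens =
    ≈-trans (≈-trans (≈-trans selected≈parsing parsing≈average) average≈all) all≈M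
    where
    P Dk X e G H : ℕ
    P = sel M
    Dk = b ^ length c
    X = q * b ^ W
    e = windowError P
    G = sumWords b W (weight (parses c))
    H = sumWords b W (weight (λ _ → true))
    Dk*G≡H : Dk * G ≡ H
    Dk*G≡H = sumWords-weight-parses c span≤R
    selected≈parsing : X * (Dk * count selected c M) ≈[ X * (Dk * e) ] X * (Dk * weightCount (parses c) P)
    selected≈parsing = ≈-*ˡ X (≈-*ˡ Dk (≈-respˡ (sym (count-selected c M))
      (selectedCount≈weightCount (parsesAt x c) (parses c) (λ p → parsesAt-window x c p R span≤R) P)))
    parsing≈average : X * (Dk * weightCount (parses c) P) ≈[ H * P ] q * (H * P)
    parsing≈average =
      ≈-resp-error (trans (sym (*-assoc Dk G P)) (cong (_* P) Dk*G≡H))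
        (≈-respʳ (trans (x*[y*[z*w]]≡y*[x*z*w] Dk q G P) (cong (λ z → q * (z * P)) Dk*G≡H))
          (≈-respˡ (x*[y*[z*w]]≡y*z*[x*w] Dk q (b ^ W) _)
            (≈-*ˡ Dk (sumTo-window-≈ x W q P (weight (parses c)) dens))))
      where
      x*[y*[z*w]]≡y*z*[x*w] : ∀ x y z w → x * (y * (z * w)) ≡ y * z * (x * w)
      x*[y*[z*w]]≡y*z*[x*w] = solve-∀
      x*[y*[z*w]]≡y*[x*z*w] : ∀ x y z w → x * (y * (z * w)) ≡ y * (x * z * w)
      x*[y*[z*w]]≡y*[x*z*w] = solve-∀
    average≈all : q * (H * P) ≈[ H * P ] X * weightCount (λ _ → true) P
    average≈all = ≈-sym (≈-respˡ (sym (*-assoc q (b ^ W) _)) (sumTo-window-≈ x W q P (weight (λ _ → true)) dens))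
    all≈M : X * weightCount (λ _ → true) P ≈[ X * e ] X * M
    all≈M = ≈-*ˡ X (≈-sym (≈-respˡ (sym (M≡sumTo-state≡0 M))
              (selectedCount≈weightCount (λ _ → true) (λ _ → true) (λ _ → refl) P)))

-- The error terms of count-selected-≈ are small against X·M once b^W is large against the
-- unsynchronised windows (hypothesis on β) and M is large against the constant terms.
error-budget : ∀ q b Dk BW β m₀ M P L Ba H →
  let q' = 2 * q * b + 2
      X = q' * BW
      e = L + (Ba + m₀)
  in H ≤ BW → X * Ba ≤ (q' + 1) * β * P → P ≤ m₀ + M * b → q * (Dk + 1) * (q' + 1) * b * β ≤ BW →
     2 * q * BW * m₀ + q * (Dk + 1) * (q' + 1) * β * m₀ + q * (Dk + 1) * X * (L + m₀) ≤ M → 1 ≤ BW →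
     q * (X * (Dk * e) + H * P + H * P + X * e) ≤ X * M
error-budget q b Dk BW β m₀ M P L Ba H H≤BW X*Ba≤ P≤ Cβ≤BW K≤M 1≤BW = begin
  q * (X * (Dk * e) + H * P + H * P + X * e)
    ≡⟨ expand q X Dk L Ba m₀ H P ⟩
  c * X * (L + m₀) + c * (X * Ba) + 2 * q * (H * P)
    ≤⟨ +-mono-≤ (+-monoʳ-≤ (c * X * (L + m₀)) (*-monoʳ-≤ c X*Ba≤)) (*-monoʳ-≤ (2 * q) (*-monoˡ-≤ P H≤BW)) ⟩
  c * X * (L + m₀) + c * ((q' + 1) * β * P) + 2 * q * (BW * P)
    ≡⟨ reassoc c X L m₀ q' β P q BW ⟩
  c * X * (L + m₀) + c * ((q' + 1) * β) * P + 2 * q * BW * P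
    ≤⟨ +-mono-≤ (+-monoʳ-≤ (c * X * (L + m₀)) (*-monoʳ-≤ (c * ((q' + 1) * β)) P≤)) (*-monoʳ-≤ (2 * q * BW) P≤) ⟩
  c * X * (L + m₀) + c * ((q' + 1) * β) * (m₀ + M * b) + 2 * q * BW * (m₀ + M * b)
    ≡⟨ collect c X L m₀ q' β M b q BW ⟩
  K + c * (q' + 1) * β * b * M + 2 * q * b * BW * M
    ≤⟨ +-monoˡ-≤ (2 * q * b * BW * M) (+-mono-≤ (≤-trans K≤M (m≤m*n M BW {{>-nonZero 1≤BW}})) (*-monoˡ-≤ M Cβb≤BW)) ⟩
  M * BW + BW * M + 2 * q * b * BW * M
    ≡⟨ collect-M M BW q b ⟩
  X * M ∎
  where
  open ≤-Reasoning
  q' X e c K : ℕ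
  q' = 2 * q * b + 2
  X = q' * BW
  e = L + (Ba + m₀)
  c = q * (Dk + 1)
  K = 2 * q * BW * m₀ + c * (q' + 1) * β * m₀ + c * X * (L + m₀)
  Cβb≤BW : c * (q' + 1) * β * b ≤ BW
  Cβb≤BW = ≤-trans (≤-reflexive (swap c (q' + 1) β b)) Cβ≤BW
    where
    swap : ∀ c r β b → c * r * β * b ≡ c * r * b * β
    swap = solve-∀
  expand : ∀ q X Dk L Ba m₀ H P →
    q * (X * (Dk * (L + (Ba + m₀))) + H * P + H * P + X * (L + (Ba + m₀)))
    ≡ q * (Dk + 1) * X * (L + m₀) + q * (Dk + 1) * (X * Ba) + 2 * q * (H * P)
  expand = solve-∀
  reassoc : ∀ c X L m₀ q' β P q BW →
    c * X * (L + m₀) + c * ((q' + 1) * β * P) + 2 * q * (BW * P)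
    ≡ c * X * (L + m₀) + c * ((q' + 1) * β) * P + 2 * q * BW * P
  reassoc = solve-∀
  collect : ∀ c X L m₀ q' β M b q BW →
    c * X * (L + m₀) + c * ((q' + 1) * β) * (m₀ + M * b) + 2 * q * BW * (m₀ + M * b)
    ≡ (2 * q * BW * m₀ + c * (q' + 1) * β * m₀ + c * X * (L + m₀)) + c * (q' + 1) * β * b * M + 2 * q * b * BW * M
  collect = solve-∀
  collect-M : ∀ M BW q b → M * BW + BW * M + 2 * q * b * BW * M ≡ (2 * q * b + 2) * BW * M
  collect-M = solve-∀

selected-HasDensity : ∀ t → 1 ≤ t → (x : ℕ → Fin (suc t)) → Normal (suc t) x →
  ∀ m₀ (c : List (Fin (suc t))) → 1 ≤ length c → HasDensity (count (Selection.selected x m₀) c) (suc t ^ length c)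
selected-HasDensity t 1≤t x normal m₀ c 1≤k q = N₀ ⊔ K , bound
  where
  open Selection x m₀
  Dk q' A C : ℕ
  Dk = suc t ^ length c
  q' = 2 * q * suc t + 2
  A = suc t ^ t ∸ 1
  C = q * (Dk + 1) * (q' + 1) * suc t
  -- Windows of length W = L + R with R = k·b ≥ span c and L = j·t for j = C·A, so that by
  -- unsynced-rare the unsynchronised windows form a fraction at most 1/C of all of them.
  open Windows t x m₀ (C * A) (length c * suc t)
  BW β X K N₀ : ℕ
  BW = b ^ W
  β = A ^ (C * A) * b ^ (length c * b)
  X = q' * BW
  K = 2 * q * BW * m₀ + q * (Dk + 1) * (q' + 1) * β * m₀ + q * (Dk + 1) * X * (L + m₀)
  1≤W : 1 ≤ W
  1≤W = ≤-trans (*-mono-≤ 1≤k (s≤s (z≤n {t}))) (m≤n+m (length c * b) L)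
  N₀ = proj₁ (normal⇒DensitiesAt x normal W 1≤W q')
  bound : ∀ M → N₀ ⊔ K ≤ M → q * (Dk * count selected c M) ≈[ M ] q * M
  bound M N≤M = ≈-cancel-*ˡ X q {{X≢0}} (count-selected-≈ c (span≤ c) q' M densities)
                  (error-budget q b Dk BW β m₀ M P L (unsyncedCount P) H sumWords-weight-all≤
                                unsynced≤ (sel≤ x m₀ M) (unsynced-rare t C (length c * b) 1≤t)
                                (≤-trans (m≤n⊔m N₀ K) N≤M) (m^n>0 b W))
    where
    P H : ℕ
    P = sel M
    H = sumWords b W (weight (λ _ → true))
    X≢0 : NonZero X
    X≢0 = m*n≢0 q' BW {{>-nonZero (≤-trans (s≤s z≤n) (m≤n+m 2 (2 * q * b)))}} {{m^n≢0 b W}}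
    densities : DensitiesAt x W q' P
    densities = proj₂ (normal⇒DensitiesAt x normal W 1≤W q') P (≤-trans (m≤m⊔n N₀ K) (≤-trans N≤M (n≤sel x m₀ M)))
    unsynced≤ : X * unsyncedCount P ≤ (q' + 1) * β * P
    unsynced≤ = ≤-trans (≤-reflexive (*-assoc q' BW _))
                  (≤-trans (proj₁ (≈-resp-error (cong (_* P) sumWords-unsynced)
                                    (≈-respʳ (cong (λ z → q' * (z * P)) sumWords-unsynced)
                                      (sumTo-window-≈ x W q' P unsynced densities))))
                           (≤-reflexive (collect q' β P)))
      where
      collect : ∀ q β P → q * (β * P) + β * P ≡ (q + 1) * β * P
      collect = solve-∀

theorem1p1 : (b : ℕ) → 2 ≤ b → (a : ℕ → Fin b) → Normal b (λ i → a (suc i)) →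
    (n₁ : ℕ) → 1 ≤ n₁ → Normal b (λ i → a (idx a n₁ i))
theorem1p1 (suc t) (s≤s 1≤t) a normal (suc m₀) _ c 1≤k =
  HasDensity⇒ConvergesTo (λ i → a (idx a (suc m₀) i)) c
    (HasDensity-cong (suc t ^ length c)
      (count-cong (λ i → cong a (sym (idx≡1+sel a m₀ i))) c)
      (selected-HasDensity t 1≤t (λ i → a (suc i)) normal m₀ c 1≤k))
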